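{- Let $G$ be a graph and let $k$ be a positive integer. Then the family of (edge sets of) subgraphs $K\subseteq G$ with $m_2(K)\le k$ is the collection of independent sets of a matroid on the ground set $E(G)$.
   Context: Subgraphs of $G$ are identified with subsets of $E(G)$, with $v_J$ the number of vertices incident to an edge of $J$ and $e_J=|J|$. For a graph $H$: $m_2(H)=\max\{(e_J-1)/(v_J-2): J\subseteq H, v_J\ge 3\}$ if $H$ has an edge and $v_H\ge3$; $m_2(K_2)=1/2$; $m_2(H)=0$ if $H$ has no edges. -}

module Defs where

open import Data.Nat using (ℕ; _≤_; _*_; _∸_; _<_)
open import Data.Fin using (Fin)
open import Data.Fin.Subset using (Subset; ⊥; ⁅_⁆; _∪_; ⋃; ∣_∣; _⊆_; _∈_; _∉_)
open import Data.Bool using (if_then_else_)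
open import Data.Vec using (lookup)
open import Data.List using (List; map; allFin)
open import Data.Product using (_×_; proj₁; proj₂; ∃; _,_)
open import Data.Sum using (_⊎_)
open import Relation.Binary.PropositionalEquality using (_≡_; _≢_)

record Graph : Set where
  field
    V     : ℕ
    E     : ℕ
    ends  : Fin E → Fin V × Fin V
    loopless : ∀ e → proj₁ (ends e) ≢ proj₂ (ends e)
    simple   : ∀ e f →
      ((proj₁ (ends e) ≡ proj₁ (ends f) × proj₂ (ends e) ≡ proj₂ (ends f))
       ⊎ (proj₁ (ends e) ≡ proj₂ (ends f) × proj₂ (ends e) ≡ proj₁ (ends f)))
      → e ≡ f

module _ (G : Graph) where
  open Graph G

  -- Subgraphs of G are identified with subsets of E(G).

  vertexSet : Subset E → Subset V
  vertexSet J = ⋃ (map (λ e → if lookup J e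
                                 then ⁅ proj₁ (ends e) ⁆ ∪ ⁅ proj₂ (ends e) ⁆
                                 else ⊥)
                       (allFin E))

  vtx : Subset E → ℕ
  vtx J = ∣ vertexSet J ∣

  edg : Subset E → ℕ
  edg J = ∣ J ∣

  -- "m_2(H) ≤ k" for a natural number k, following the three-case
  -- definition of m_2:
  --  * H has no edges: m_2(H) = 0, so the condition is 0 ≤ k;
  --  * H = K_2 (one edge, two vertices): m_2(H) = 1/2, so 1/2 ≤ k, i.e. 1 ≤ 2k;
  --  * H has an edge and v_H ≥ 3: m_2(H) is the maximum of
  --    (e_J - 1)/(v_J - 2) over J ⊆ H with v_J ≥ 3, and the maximum is ≤ k
  --    iff every such ratio is ≤ k, i.e. e_J - 1 ≤ k (v_J - 2)
  --    (denominator v_J - 2 > 0; e_J ≥ 1 since v_J ≥ 3).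
  m₂≤ : Subset E → ℕ → Set
  m₂≤ H k =
      (edg H ≡ 0 → 0 ≤ k)
    × (edg H ≡ 1 → vtx H ≡ 2 → 1 ≤ 2 * k)
    × (1 ≤ edg H → 3 ≤ vtx H →
         ∀ (J : Subset E) → J ⊆ H → 3 ≤ vtx J →
         edg J ∸ 1 ≤ k * (vtx J ∸ 2))

record IsMatroid (n : ℕ) (I : Subset n → Set) : Set where
  field
    empty-indep : I ⊥
    hereditary  : ∀ {A B} → A ⊆ B → I B → I A
    augmentation : ∀ {A B} → I A → I B → ∣ A ∣ < ∣ B ∣ →
                   ∃ λ x → x ∈ B × x ∉ A × I (A ∪ ⁅ x ⁆)

{-# OPTIONS --safe #-}
-- Writing m₂(J) ≤ k as |J| ≤ k·v_J − (2k − 1) for every nonempty J, the family is the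
-- count matroid of the submodular function J ↦ k·v_J − (2k − 1), and only augmentation needs
-- work. Given sparse A, B with |A| < |B|, take a nonempty tight T ⊆ A (a single edge is
-- tight). A sparse set has at most |T| edges inside G[V(T)], so induction on |A|, applied to
-- A ∖ T and to the edges of B outside G[V(T)], yields y ∈ B outside G[V(T)] with (A ∖ T) + y
-- sparse. If A + y is not sparse, an overfull J ∋ y meets T, and by submodularity
-- (J ∪ T) − y is a tight subset of A, strictly larger than T, whose vertex set contains the
-- ends of y; T can be enlarged in this way only finitely often.
module Submission where

open import Defs
open import Data.Bool using (true; false; _∧_; if_then_else_)
open import Data.Bool.Properties using (∧-conicalˡ; ∧-conicalʳ)
open import Data.Empty using (⊥-elim)
open import Data.Fin using (Fin; _≟_)
open import Data.Fin.Subset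
open import Data.Fin.Subset.Properties
open import Data.List as List using (List; map; allFin)
open import Data.List.Membership.Propositional using () renaming (_∈_ to _∈ₗ_)
open import Data.List.Membership.Propositional.Properties using (∈-map⁺; ∈-map⁻; ∈-allFin)
import Data.List.Relation.Unary.Any as Any
open import Data.Nat using (ℕ; zero; suc; _+_; _*_; _∸_; _≤_; _<_; z≤n; s≤s; >-nonZero)
open import Data.Nat.Properties hiding (_≟_)
open import Data.Nat.Tactic.RingSolver using (solve-∀)
open import Data.Product using (_×_; _,_; proj₁; proj₂; ∃)
open import Data.Sum using (_⊎_; inj₁; inj₂)
open import Data.Vec using ([]; _∷_; here; there; lookup; tabulate)
open import Data.Vec.Properties using ([]=⇒lookup; lookup⇒[]=; lookup∘tabulate)
open import Function.Bundles using (_⇔_; mk⇔; Equivalence)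
open import Relation.Binary.PropositionalEquality
open import Relation.Nullary using (yes; no)
open import Relation.Nullary.Decidable using (_×-dec_)

∣p─q∣+∣p∩q∣≡∣p∣ : ∀ {n} (p q : Subset n) → ∣ p ─ q ∣ + ∣ p ∩ q ∣ ≡ ∣ p ∣
∣p─q∣+∣p∩q∣≡∣p∣ []           []           = refl
∣p─q∣+∣p∩q∣≡∣p∣ (inside ∷ p)  (inside ∷ q)  = trans (+-suc _ _) (cong suc (∣p─q∣+∣p∩q∣≡∣p∣ p q))
∣p─q∣+∣p∩q∣≡∣p∣ (inside ∷ p)  (outside ∷ q) = cong suc (∣p─q∣+∣p∩q∣≡∣p∣ p q)
∣p─q∣+∣p∩q∣≡∣p∣ (outside ∷ p) (inside ∷ q)  = ∣p─q∣+∣p∩q∣≡∣p∣ p q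
∣p─q∣+∣p∩q∣≡∣p∣ (outside ∷ p) (outside ∷ q) = ∣p─q∣+∣p∩q∣≡∣p∣ p q

∣p∪q∣+∣p∩q∣≡∣p∣+∣q∣ : ∀ {n} (p q : Subset n) → ∣ p ∪ q ∣ + ∣ p ∩ q ∣ ≡ ∣ p ∣ + ∣ q ∣
∣p∪q∣+∣p∩q∣≡∣p∣+∣q∣ []           []           = refl
∣p∪q∣+∣p∩q∣≡∣p∣+∣q∣ (inside ∷ p)  (inside ∷ q)  =
  cong suc (trans (+-suc _ _) (trans (cong suc (∣p∪q∣+∣p∩q∣≡∣p∣+∣q∣ p q)) (sym (+-suc _ _))))
∣p∪q∣+∣p∩q∣≡∣p∣+∣q∣ (inside ∷ p)  (outside ∷ q) = cong suc (∣p∪q∣+∣p∩q∣≡∣p∣+∣q∣ p q)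
∣p∪q∣+∣p∩q∣≡∣p∣+∣q∣ (outside ∷ p) (inside ∷ q)  =
  trans (cong suc (∣p∪q∣+∣p∩q∣≡∣p∣+∣q∣ p q)) (sym (+-suc _ _))
∣p∪q∣+∣p∩q∣≡∣p∣+∣q∣ (outside ∷ p) (outside ∷ q) = ∣p∪q∣+∣p∩q∣≡∣p∣+∣q∣ p q

∣p∣≤1+∣p-x∣ : ∀ {n} (p : Subset n) x → ∣ p ∣ ≤ suc ∣ p - x ∣
∣p∣≤1+∣p-x∣ p x = begin
  ∣ p ∣                       ≡⟨ sym (∣p─q∣+∣p∩q∣≡∣p∣ p ⁅ x ⁆) ⟩
  ∣ p - x ∣ + ∣ p ∩ ⁅ x ⁆ ∣   ≤⟨ +-monoʳ-≤ ∣ p - x ∣ (∣p∩q∣≤∣q∣ p ⁅ x ⁆) ⟩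
  ∣ p - x ∣ + ∣ ⁅ x ⁆ ∣       ≡⟨ cong (∣ p - x ∣ +_) (∣⁅x⁆∣≡1 x) ⟩
  ∣ p - x ∣ + 1               ≡⟨ +-comm ∣ p - x ∣ 1 ⟩
  suc ∣ p - x ∣               ∎
  where open ≤-Reasoning

p⊆q∧∣q∣≤∣p∣⇒q⊆p : ∀ {n} {p q : Subset n} → p ⊆ q → ∣ q ∣ ≤ ∣ p ∣ → q ⊆ p
p⊆q∧∣q∣≤∣p∣⇒q⊆p {p = []}          {[]}          _   _   = λ ()
p⊆q∧∣q∣≤∣p∣⇒q⊆p {p = inside ∷ p}  {inside ∷ q}  p⊆q (s≤s q≤p) =
  s⊆s (p⊆q∧∣q∣≤∣p∣⇒q⊆p (drop-∷-⊆ p⊆q) q≤p)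
p⊆q∧∣q∣≤∣p∣⇒q⊆p {p = inside ∷ p}  {outside ∷ q} p⊆q _ with p⊆q here
... | ()
p⊆q∧∣q∣≤∣p∣⇒q⊆p {p = outside ∷ p} {inside ∷ q}  p⊆q q≤p =
  ⊥-elim (<⇒≱ q≤p (p⊆q⇒∣p∣≤∣q∣ (drop-∷-⊆ p⊆q)))
p⊆q∧∣q∣≤∣p∣⇒q⊆p {p = outside ∷ p} {outside ∷ q} p⊆q q≤p =
  s⊆s (p⊆q∧∣q∣≤∣p∣⇒q⊆p (drop-∷-⊆ p⊆q) q≤p)

x∈p─q⇒x∉q : ∀ {n} {x : Fin n} (p q : Subset n) → x ∈ p ─ q → x ∉ q
x∈p─q⇒x∉q (_ ∷ p) (inside ∷ q)  ()        here
x∈p─q⇒x∉q (_ ∷ p) (outside ∷ q) here      ()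
x∈p─q⇒x∉q (_ ∷ p) (_ ∷ q)       (there h) (there h') = x∈p─q⇒x∉q p q h h'

x∈p∪⁅y⁆∧x≢y⇒x∈p : ∀ {n} {x y : Fin n} {p} → x ∈ p ∪ ⁅ y ⁆ → x ≢ y → x ∈ p
x∈p∪⁅y⁆∧x≢y⇒x∈p {y = y} {p} x∈ x≢y with x∈p∪q⁻ p ⁅ y ⁆ x∈
... | inj₁ x∈p = x∈p
... | inj₂ x∈y = ⊥-elim (x≢y (x∈⁅y⁆⇒x≡y y x∈y))

x∈p⇒⁅x⁆⊆p : ∀ {n} {x : Fin n} {p} → x ∈ p → ⁅ x ⁆ ⊆ p
x∈p⇒⁅x⁆⊆p {x = x} {p} x∈p y∈⁅x⁆ = subst (_∈ p) (sym (x∈⁅y⁆⇒x≡y x y∈⁅x⁆)) x∈p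

p⊆q∪⁅x⁆∧x∉p⇒p⊆q : ∀ {n} {x : Fin n} {p q} → p ⊆ q ∪ ⁅ x ⁆ → x ∉ p → p ⊆ q
p⊆q∪⁅x⁆∧x∉p⇒p⊆q p⊆ x∉p y∈p = x∈p∪⁅y⁆∧x≢y⇒x∈p (p⊆ y∈p) (λ y≡x → x∉p (subst (_∈ _) y≡x y∈p))

p⊆q∪⁅x⁆∧p∩r≡∅⇒p⊆q─r∪⁅x⁆ : ∀ {n} {x : Fin n} {p q r} → p ⊆ q ∪ ⁅ x ⁆ → Empty (p ∩ r) →
                           p ⊆ (q ─ r) ∪ ⁅ x ⁆
p⊆q∪⁅x⁆∧p∩r≡∅⇒p⊆q─r∪⁅x⁆ {x = x} {p} {q} {r} p⊆ p∩r≡∅ {y} y∈p with x∈p∪q⁻ q ⁅ x ⁆ (p⊆ y∈p)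
... | inj₁ y∈q = x∈p∪q⁺ (inj₁ (x∈p∧x∉q⇒x∈p─q y∈q (λ y∈r → p∩r≡∅ (y , x∈p∩q⁺ (y∈p , y∈r)))))
... | inj₂ y∈x = x∈p∪q⁺ (inj₂ y∈x)

x∈p⇒0<∣p∣ : ∀ {n} {x : Fin n} {p} → x ∈ p → 0 < ∣ p ∣
x∈p⇒0<∣p∣ x∈p = ≤-trans (s≤s z≤n) (x∈p⇒∣p-x∣<∣p∣ x∈p)

Empty⇒∣p∣≡0 : ∀ {n} {p : Subset n} → Empty p → ∣ p ∣ ≡ 0
Empty⇒∣p∣≡0 {n} empty = trans (cong ∣_∣ (Empty-unique empty)) (∣⊥∣≡0 n)

0<∣p∣⇒Nonempty : ∀ {n} {p : Subset n} → 0 < ∣ p ∣ → Nonempty p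
0<∣p∣⇒Nonempty {p = p} 0<∣p∣ with nonempty? p
... | yes ne    = ne
... | no  empty = ⊥-elim (<⇒≢ 0<∣p∣ (sym (Empty⇒∣p∣≡0 empty)))

x≢y⇒1<∣p∣ : ∀ {n} {x y : Fin n} {p} → x ≢ y → x ∈ p → y ∈ p → 1 < ∣ p ∣
x≢y⇒1<∣p∣ x≢y x∈p y∈p =
  ≤-trans (s≤s (x∈p⇒0<∣p∣ (x∈p∧x≢y⇒x∈p-y x∈p x≢y))) (x∈p⇒∣p-x∣<∣p∣ y∈p)

distinct⇒2<∣p∣ : ∀ {n} {x y z : Fin n} {p} → x ≢ y → x ≢ z → y ≢ z →
                 x ∈ p → y ∈ p → z ∈ p → 2 < ∣ p ∣
distinct⇒2<∣p∣ x≢y x≢z y≢z x∈p y∈p z∈p =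
  ≤-trans (s≤s (x≢y⇒1<∣p∣ x≢y (x∈p∧x≢y⇒x∈p-y x∈p x≢z) (x∈p∧x≢y⇒x∈p-y y∈p y≢z)))
          (x∈p⇒∣p-x∣<∣p∣ z∈p)

x∈⋃⁺ : ∀ {n} {x : Fin n} {p} (ps : List (Subset n)) → p ∈ₗ ps → x ∈ p → x ∈ ⋃ ps
x∈⋃⁺ (q List.∷ ps) (Any.here refl) x∈q = x∈p∪q⁺ (inj₁ x∈q)
x∈⋃⁺ (q List.∷ ps) (Any.there p∈) x∈p = x∈p∪q⁺ (inj₂ (x∈⋃⁺ ps p∈ x∈p))

x∈⋃⁻ : ∀ {n} {x : Fin n} (ps : List (Subset n)) → x ∈ ⋃ ps → ∃ λ p → p ∈ₗ ps × x ∈ p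
x∈⋃⁻ List.[] x∈ = ⊥-elim (∉⊥ x∈)
x∈⋃⁻ (q List.∷ ps) x∈ with x∈p∪q⁻ q (⋃ ps) x∈
... | inj₁ x∈q = q , Any.here refl , x∈q
... | inj₂ x∈⋃ with x∈⋃⁻ ps x∈⋃
...   | p , p∈ , x∈p = p , Any.there p∈ , x∈p

∸1≤*∸2⇔+2*≤*+1 : ∀ k n {v} → 2 ≤ v → n ∸ 1 ≤ k * (v ∸ 2) ⇔ n + 2 * k ≤ k * v + 1
∸1≤*∸2⇔+2*≤*+1 k n {suc (suc w)} (s≤s (s≤s _)) = mk⇔
  (λ h → subst (n + 2 * k ≤_) (shift k w) (+-monoˡ-≤ (2 * k) (∸1≤⇒≤1+ n h)))
  (λ h → m≤n+o⇒m∸n≤o n 1 (+-cancelʳ-≤ (2 * k) n _ (subst (n + 2 * k ≤_) (sym (shift k w)) h)))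
  where
  shift : ∀ k w → 1 + k * w + 2 * k ≡ k * (2 + w) + 1
  shift = solve-∀
  ∸1≤⇒≤1+ : ∀ m {o} → m ∸ 1 ≤ o → m ≤ 1 + o
  ∸1≤⇒≤1+ zero    _ = z≤n
  ∸1≤⇒≤1+ (suc m) h = s≤s h

escape-increasing : ∀ {a p r} {X : Set a} {R : Set r} (P : X → Set p) (size : X → ℕ) (N : ℕ) →
                    (∀ {x} → P x → size x ≤ N) →
                    (∀ {x} → P x → R ⊎ ∃ λ x′ → P x′ × size x < size x′) →
                    ∀ {x} → P x → R
escape-increasing {R = R} P size N bounded step Px = go N Px (m≤m+n N _)
  where
  go : ∀ m {x} → P x → N ≤ m + size x → R
  go m Px N≤ with step Px
  ... | inj₁ r = r
  go zero    Px N≤ | inj₂ (x′ , Px′ , lt) = ⊥-elim (<⇒≱ lt (≤-trans (bounded Px′) N≤))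
  go (suc m) Px N≤ | inj₂ (x′ , Px′ , lt) = go m Px′ (≤-trans N≤ (+-monoʳ-< m lt))

IsMatroid-transfer : ∀ {n} {I J : Subset n → Set} →
                     (∀ {X} → I X → J X) → (∀ {X} → J X → I X) → IsMatroid n I → IsMatroid n J
IsMatroid-transfer {I = I} {J} to from M = record
  { empty-indep  = to empty-indep
  ; hereditary   = λ A⊆B JB → to (hereditary A⊆B (from JB))
  ; augmentation = λ JA JB ∣A∣<∣B∣ → lift (augmentation (from JA) (from JB) ∣A∣<∣B∣)
  }
  where
  open IsMatroid M
  lift : ∀ {A B} → (∃ λ x → x ∈ B × x ∉ A × I (A ∪ ⁅ x ⁆)) → ∃ λ x → x ∈ B × x ∉ A × J (A ∪ ⁅ x ⁆)
  lift (x , x∈B , x∉A , Ix) = x , x∈B , x∉A , to Ix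

module _ (G : Graph) where
  open Graph G

  end₁ end₂ : Fin E → Fin V
  end₁ e = proj₁ (ends e)
  end₂ e = proj₂ (ends e)

  endpoints : Fin E → Subset V
  endpoints e = ⁅ end₁ e ⁆ ∪ ⁅ end₂ e ⁆

  end₁∈endpoints : ∀ e → end₁ e ∈ endpoints e
  end₁∈endpoints e = x∈p∪q⁺ (inj₁ (x∈⁅x⁆ (end₁ e)))

  end₂∈endpoints : ∀ e → end₂ e ∈ endpoints e
  end₂∈endpoints e = x∈p∪q⁺ (inj₂ (x∈⁅x⁆ (end₂ e)))

  endpoints⊆ : ∀ {e W} → end₁ e ∈ W → end₂ e ∈ W → endpoints e ⊆ W
  endpoints⊆ {e} {W} e₁∈W e₂∈W v∈ with x∈p∪q⁻ ⁅ end₁ e ⁆ ⁅ end₂ e ⁆ v∈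
  ... | inj₁ v∈e₁ = subst (_∈ W) (sym (x∈⁅y⁆⇒x≡y _ v∈e₁)) e₁∈W
  ... | inj₂ v∈e₂ = subst (_∈ W) (sym (x∈⁅y⁆⇒x≡y _ v∈e₂)) e₂∈W

  ∣endpoints∣≤2 : ∀ e → ∣ endpoints e ∣ ≤ 2
  ∣endpoints∣≤2 e = begin
    ∣ endpoints e ∣                              ≤⟨ m≤m+n _ _ ⟩
    ∣ endpoints e ∣ + ∣ ⁅ end₁ e ⁆ ∩ ⁅ end₂ e ⁆ ∣ ≡⟨ ∣p∪q∣+∣p∩q∣≡∣p∣+∣q∣ ⁅ end₁ e ⁆ ⁅ end₂ e ⁆ ⟩
    ∣ ⁅ end₁ e ⁆ ∣ + ∣ ⁅ end₂ e ⁆ ∣               ≡⟨ cong₂ _+_ (∣⁅x⁆∣≡1 (end₁ e)) (∣⁅x⁆∣≡1 (end₂ e)) ⟩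
    2                                            ∎
    where open ≤-Reasoning

  incident : Subset E → Fin E → Subset V
  incident J e = if lookup J e then endpoints e else ⊥

  ∈vertexSet⁺ : ∀ {J e} → e ∈ J → endpoints e ⊆ vertexSet G J
  ∈vertexSet⁺ {J} {e} e∈J v∈ = x∈⋃⁺ (map (incident J) (allFin E)) (∈-map⁺ (incident J) (∈-allFin e))
    (subst (λ b → _ ∈ (if b then endpoints e else ⊥)) (sym ([]=⇒lookup e∈J)) v∈)

  ∈vertexSet⁻ : ∀ {J v} → v ∈ vertexSet G J → ∃ λ e → e ∈ J × v ∈ endpoints e
  ∈vertexSet⁻ {J} {v} v∈ with x∈⋃⁻ (map (incident J) (allFin E)) v∈
  ... | p , p∈ , v∈p with ∈-map⁻ (incident J) p∈
  ...   | e , _ , refl with lookup J e in eq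
  ...     | true  = e , lookup⇒[]= e J eq , v∈p
  ...     | false = ⊥-elim (∉⊥ v∈p)

  vertexSet-least : ∀ {J W} → (∀ {e} → e ∈ J → endpoints e ⊆ W) → vertexSet G J ⊆ W
  vertexSet-least ends⊆W v∈ with ∈vertexSet⁻ v∈
  ... | e , e∈J , v∈e = ends⊆W e∈J v∈e

  vertexSet-mono : ∀ {J K} → J ⊆ K → vertexSet G J ⊆ vertexSet G K
  vertexSet-mono J⊆K = vertexSet-least (λ e∈J → ∈vertexSet⁺ (J⊆K e∈J))

  vtx-mono : ∀ {J K} → J ⊆ K → vtx G J ≤ vtx G K
  vtx-mono J⊆K = p⊆q⇒∣p∣≤∣q∣ (vertexSet-mono J⊆K)

  vertexSet-∪ : ∀ J K → vertexSet G (J ∪ K) ⊆ vertexSet G J ∪ vertexSet G K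
  vertexSet-∪ J K = vertexSet-least λ e∈J∪K v∈ → x∈p∪q⁺ (Data.Sum.map
    (λ e∈J → ∈vertexSet⁺ e∈J v∈) (λ e∈K → ∈vertexSet⁺ e∈K v∈) (x∈p∪q⁻ J K e∈J∪K))

  vertexSet-∩ : ∀ J K → vertexSet G (J ∩ K) ⊆ vertexSet G J ∩ vertexSet G K
  vertexSet-∩ J K = vertexSet-least λ e∈J∩K v∈ → let (e∈J , e∈K) = x∈p∩q⁻ J K e∈J∩K in
    x∈p∩q⁺ (∈vertexSet⁺ e∈J v∈ , ∈vertexSet⁺ e∈K v∈)

  vtx-submodular : ∀ J K → vtx G (J ∪ K) + vtx G (J ∩ K) ≤ vtx G J + vtx G K
  vtx-submodular J K = begin
    vtx G (J ∪ K) + vtx G (J ∩ K)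
      ≤⟨ +-mono-≤ (p⊆q⇒∣p∣≤∣q∣ (vertexSet-∪ J K)) (p⊆q⇒∣p∣≤∣q∣ (vertexSet-∩ J K)) ⟩
    ∣ vertexSet G J ∪ vertexSet G K ∣ + ∣ vertexSet G J ∩ vertexSet G K ∣
      ≡⟨ ∣p∪q∣+∣p∩q∣≡∣p∣+∣q∣ (vertexSet G J) (vertexSet G K) ⟩
    vtx G J + vtx G K
      ∎
    where open ≤-Reasoning

  1<vtx : ∀ {J e} → e ∈ J → 1 < vtx G J
  1<vtx {e = e} e∈J =
    x≢y⇒1<∣p∣ (loopless e) (∈vertexSet⁺ e∈J (end₁∈endpoints e)) (∈vertexSet⁺ e∈J (end₂∈endpoints e))

  vtx⁅e⁆≤2 : ∀ e → vtx G ⁅ e ⁆ ≤ 2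
  vtx⁅e⁆≤2 e = ≤-trans (p⊆q⇒∣p∣≤∣q∣ (vertexSet-least ends⊆)) (∣endpoints∣≤2 e)
    where
    ends⊆ : ∀ {f} → f ∈ ⁅ e ⁆ → endpoints f ⊆ endpoints e
    ends⊆ f∈ rewrite x∈⁅y⁆⇒x≡y e f∈ = λ v∈ → v∈

  0<vtx⇒Nonempty : ∀ {J} → 0 < vtx G J → Nonempty J
  0<vtx⇒Nonempty 0<vJ with 0<∣p∣⇒Nonempty 0<vJ
  ... | v , v∈ with ∈vertexSet⁻ v∈
  ...   | e , e∈J , _ = e , e∈J

  three-vertices : ∀ {J e f v} → e ∈ J → f ∈ J → v ∈ endpoints f →
                   end₁ e ≢ v → end₂ e ≢ v → 2 < vtx G J
  three-vertices {e = e} e∈J f∈J v∈f e₁≢v e₂≢v = distinct⇒2<∣p∣ (loopless e) e₁≢v e₂≢v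
    (∈vertexSet⁺ e∈J (end₁∈endpoints e)) (∈vertexSet⁺ e∈J (end₂∈endpoints e)) (∈vertexSet⁺ f∈J v∈f)

  distinct-edges⇒2<vtx : ∀ {J e f} → e ∈ J → f ∈ J → f ≢ e → 2 < vtx G J
  distinct-edges⇒2<vtx {J} {e} {f} e∈J f∈J f≢e with end₁ f ≟ end₁ e | end₁ f ≟ end₂ e
  ... | yes f₁≡e₁ | _ = three-vertices e∈J f∈J (end₂∈endpoints f)
    (λ e₁≡f₂ → loopless f (trans f₁≡e₁ e₁≡f₂))
    (λ e₂≡f₂ → f≢e (sym (simple e f (inj₁ (sym f₁≡e₁ , e₂≡f₂)))))
  ... | no _ | yes f₁≡e₂ = three-vertices e∈J f∈J (end₂∈endpoints f)
    (λ e₁≡f₂ → f≢e (sym (simple e f (inj₂ (e₁≡f₂ , sym f₁≡e₂)))))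
    (λ e₂≡f₂ → loopless f (trans f₁≡e₂ e₂≡f₂))
  ... | no f₁≢e₁ | no f₁≢e₂ = three-vertices e∈J f∈J (end₁∈endpoints f)
    (λ e₁≡f₁ → f₁≢e₁ (sym e₁≡f₁)) (λ e₂≡f₁ → f₁≢e₂ (sym e₂≡f₁))

  vtx≤2⇒⊆⁅e⁆ : ∀ {J e} → vtx G J ≤ 2 → e ∈ J → J ⊆ ⁅ e ⁆
  vtx≤2⇒⊆⁅e⁆ {e = e} vJ≤2 e∈J {f} f∈J with f ≟ e
  ... | yes refl = x∈⁅x⁆ e
  ... | no  f≢e  = ⊥-elim (<⇒≱ (distinct-edges⇒2<vtx e∈J f∈J f≢e) vJ≤2)

  induced : Subset V → Subset E
  induced W = tabulate (λ e → lookup W (end₁ e) ∧ lookup W (end₂ e))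

  ∈induced⁺ : ∀ {W e} → endpoints e ⊆ W → e ∈ induced W
  ∈induced⁺ {W} {e} ends⊆W = lookup⇒[]= e (induced W) (trans (lookup∘tabulate _ e)
    (cong₂ _∧_ ([]=⇒lookup (ends⊆W (end₁∈endpoints e))) ([]=⇒lookup (ends⊆W (end₂∈endpoints e)))))

  ∈induced⁻ : ∀ {W e} → e ∈ induced W → endpoints e ⊆ W
  ∈induced⁻ {W} {e} e∈ = endpoints⊆ (lookup⇒[]= _ W (∧-conicalˡ _ _ both)) (lookup⇒[]= _ W (∧-conicalʳ _ _ both))
    where
    both : lookup W (end₁ e) ∧ lookup W (end₂ e) ≡ true
    both = trans (sym (lookup∘tabulate _ e)) ([]=⇒lookup e∈)

module Sparsity (G : Graph) (k : ℕ) (1≤k : 1 ≤ k) where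
  open Graph G using (E)

  -- |J| ≤ k·v_J − (2k − 1), with the subtraction moved across the inequality.
  Bounded : Subset E → Set
  Bounded J = ∣ J ∣ + 2 * k ≤ k * vtx G J + 1

  Overfull : Subset E → Set
  Overfull J = k * vtx G J + 1 < ∣ J ∣ + 2 * k

  Tight : Subset E → Set
  Tight T = k * vtx G T + 1 ≤ ∣ T ∣ + 2 * k

  Sparse : Subset E → Set
  Sparse X = ∀ {J} → J ⊆ X → Nonempty J → Bounded J

  m₂≤⇒Sparse : ∀ {H} → m₂≤ G H k → Sparse H
  m₂≤⇒Sparse {H} (_ , _ , dense) {J} J⊆H (e , e∈J) =
    Equivalence.to (∸1≤*∸2⇔+2*≤*+1 k ∣ J ∣ (1<vtx G e∈J)) bound
    where
    bound : ∣ J ∣ ∸ 1 ≤ k * (vtx G J ∸ 2)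
    bound with 3 ≤? vtx G J
    ... | yes 3≤vJ = dense (x∈p⇒0<∣p∣ (J⊆H e∈J)) (≤-trans 3≤vJ (vtx-mono G J⊆H)) J J⊆H 3≤vJ
    ... | no  3≰vJ = subst (_≤ k * (vtx G J ∸ 2)) (sym (m≤n⇒m∸n≡0 ∣J∣≤1)) z≤n
      where
      ∣J∣≤1 : ∣ J ∣ ≤ 1
      ∣J∣≤1 = subst (∣ J ∣ ≤_) (∣⁅x⁆∣≡1 e) (p⊆q⇒∣p∣≤∣q∣ (vtx≤2⇒⊆⁅e⁆ G (≮⇒≥ 3≰vJ) e∈J))

  Sparse⇒m₂≤ : ∀ {H} → Sparse H → m₂≤ G H k
  Sparse⇒m₂≤ sparse =
      (λ _ → z≤n)
    , (λ _ _ → ≤-trans 1≤k (m≤m+n k _))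
    , λ _ _ J J⊆H 3≤vJ → Equivalence.from (∸1≤*∸2⇔+2*≤*+1 k ∣ J ∣ (≤-trans (n≤1+n 2) 3≤vJ))
                           (sparse J⊆H (0<vtx⇒Nonempty G (≤-trans (s≤s z≤n) 3≤vJ)))

  Sparse-⊆ : ∀ {A B} → A ⊆ B → Sparse B → Sparse A
  Sparse-⊆ A⊆B sparse J⊆A = sparse (⊆-trans J⊆A A⊆B)

  Sparse-⊥ : Sparse ⊥
  Sparse-⊥ J⊆⊥ (_ , e∈J) = ⊥-elim (∉⊥ (J⊆⊥ e∈J))

  sparse⊎overfull : ∀ X → Sparse X ⊎ ∃ λ J → J ⊆ X × Nonempty J × Overfull J
  sparse⊎overfull X
    with anySubset? (λ J → J ⊆? X ×-dec nonempty? J ×-dec (k * vtx G J + 1 <? ∣ J ∣ + 2 * k))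
  ... | yes overfull = inj₂ overfull
  ... | no  none     = inj₁ λ {J} J⊆X neJ → ≮⇒≥ (λ ov → none (J , J⊆X , neJ , ov))

  ⁅e⁆-tight : ∀ e → Tight ⁅ e ⁆
  ⁅e⁆-tight e = begin
    k * vtx G ⁅ e ⁆ + 1  ≤⟨ +-monoˡ-≤ 1 (*-monoʳ-≤ k (vtx⁅e⁆≤2 G e)) ⟩
    k * 2 + 1            ≡⟨ trans (+-comm (k * 2) 1) (cong suc (*-comm k 2)) ⟩
    1 + 2 * k            ≡⟨ cong (_+ 2 * k) (sym (∣⁅x⁆∣≡1 e)) ⟩
    ∣ ⁅ e ⁆ ∣ + 2 * k    ∎
    where open ≤-Reasoning

  sparse-below-tight : ∀ {X T} → Sparse X → Tight T → vertexSet G X ⊆ vertexSet G T → ∣ X ∣ ≤ ∣ T ∣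
  sparse-below-tight {X} {T} sparse tight VX⊆VT with nonempty? X
  ... | no  empty = subst (_≤ ∣ T ∣) (sym (Empty⇒∣p∣≡0 empty)) z≤n
  ... | yes ne    = +-cancelʳ-≤ (2 * k) ∣ X ∣ ∣ T ∣ (begin
    ∣ X ∣ + 2 * k        ≤⟨ sparse ⊆-refl ne ⟩
    k * vtx G X + 1      ≤⟨ +-monoˡ-≤ 1 (*-monoʳ-≤ k (p⊆q⇒∣p∣≤∣q∣ VX⊆VT)) ⟩
    k * vtx G T + 1      ≤⟨ tight ⟩
    ∣ T ∣ + 2 * k        ∎)
    where open ≤-Reasoning

  Overfull-∪ : ∀ {J T} → Overfull J → Tight T → Bounded (J ∩ T) → Overfull (J ∪ T)
  Overfull-∪ {J} {T} overfull tight bounded = +-cancelʳ-≤ (∣ J ∩ T ∣ + c) _ _ (begin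
    suc (k * vtx G (J ∪ T) + 1) + (∣ J ∩ T ∣ + c)
      ≤⟨ +-monoʳ-≤ (suc (k * vtx G (J ∪ T) + 1)) bounded ⟩
    suc (k * vtx G (J ∪ T) + 1) + (k * vtx G (J ∩ T) + 1)
      ≡⟨ collect k (vtx G (J ∪ T)) (vtx G (J ∩ T)) ⟩
    k * (vtx G (J ∪ T) + vtx G (J ∩ T)) + 3
      ≤⟨ +-monoˡ-≤ 3 (*-monoʳ-≤ k (vtx-submodular G J T)) ⟩
    k * (vtx G J + vtx G T) + 3
      ≡⟨ sym (collect k (vtx G J) (vtx G T)) ⟩
    suc (k * vtx G J + 1) + (k * vtx G T + 1)
      ≤⟨ +-mono-≤ overfull tight ⟩
    (∣ J ∣ + c) + (∣ T ∣ + c)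
      ≡⟨ interchange ∣ J ∣ ∣ T ∣ c ⟩
    (∣ J ∣ + ∣ T ∣) + (c + c)
      ≡⟨ cong (_+ (c + c)) (sym (∣p∪q∣+∣p∩q∣≡∣p∣+∣q∣ J T)) ⟩
    (∣ J ∪ T ∣ + ∣ J ∩ T ∣) + (c + c)
      ≡⟨ sym (interchange ∣ J ∪ T ∣ ∣ J ∩ T ∣ c) ⟩
    (∣ J ∪ T ∣ + c) + (∣ J ∩ T ∣ + c)
      ∎)
    where
    open ≤-Reasoning
    c = 2 * k
    collect : ∀ k x y → suc (k * x + 1) + (k * y + 1) ≡ k * (x + y) + 3
    collect = solve-∀
    interchange : ∀ x y c → (x + c) + (y + c) ≡ (x + y) + (c + c)
    interchange = solve-∀

  Overfull-remove : ∀ {U} y → Overfull U → Bounded (U - y) →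
                    Tight (U - y) × vertexSet G U ⊆ vertexSet G (U - y)
  Overfull-remove {U} y overfull bounded =
    ≤-trans (+-monoˡ-≤ 1 (*-monoʳ-≤ k (vtx-mono G U-y⊆U))) capU≤
    , p⊆q∧∣q∣≤∣p∣⇒q⊆p (vertexSet-mono G U-y⊆U) vU≤vU-y
    where
    U-y⊆U : U - y ⊆ U
    U-y⊆U = p─q⊆p U ⁅ y ⁆
    capU≤ : k * vtx G U + 1 ≤ ∣ U - y ∣ + 2 * k
    capU≤ = ≤-pred (≤-trans overfull (+-monoˡ-≤ (2 * k) (∣p∣≤1+∣p-x∣ U y)))
    vU≤vU-y : vtx G U ≤ vtx G (U - y)
    vU≤vU-y = *-cancelˡ-≤ k {{>-nonZero 1≤k}} (+-cancelʳ-≤ 1 _ _ (≤-trans capU≤ bounded))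

  Augmentable : Subset E → Subset E → Set
  Augmentable A B = ∃ λ x → x ∈ B × x ∉ A × Sparse (A ∪ ⁅ x ⁆)

  AugmentsBelow : ℕ → Set
  AugmentsBelow n = ∀ {A B} → ∣ A ∣ < n → Sparse A → Sparse B → ∣ A ∣ < ∣ B ∣ → Augmentable A B

  TightIn : Subset E → Subset E → Set
  TightIn A T = T ⊆ A × Nonempty T × Tight T

  augment-outside : ∀ {n A B T} → AugmentsBelow n → ∣ A ∣ ≤ n → Sparse A → Sparse B →
                    ∣ A ∣ < ∣ B ∣ → TightIn A T →
                    ∃ λ y → y ∈ B × y ∉ A × y ∉ induced G (vertexSet G T) × Sparse ((A ─ T) ∪ ⁅ y ⁆)
  augment-outside {n} {A} {B} {T} below ∣A∣≤n spA spB ∣A∣<∣B∣ (T⊆A , (e , e∈T) , tight) =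
    widen (below ∣A─T∣<n (Sparse-⊆ (p─q⊆p A T) spA) (Sparse-⊆ (p─q⊆p B S) spB) ∣A─T∣<∣B─S∣)
    where
    S = induced G (vertexSet G T)
    ∣A─T∣<n : ∣ A ─ T ∣ < n
    ∣A─T∣<n = ≤-trans (p∩q≢∅⇒∣p─q∣<∣p∣ A T (e , x∈p∩q⁺ (T⊆A e∈T , e∈T))) ∣A∣≤n
    ∣B∩S∣≤∣T∣ : ∣ B ∩ S ∣ ≤ ∣ T ∣
    ∣B∩S∣≤∣T∣ = sparse-below-tight {B ∩ S} {T} (Sparse-⊆ (p∩q⊆p B S) spB) tight
      (vertexSet-least G (λ f∈B∩S → ∈induced⁻ G (proj₂ (x∈p∩q⁻ B S f∈B∩S))))
    ∣A─T∣<∣B─S∣ : ∣ A ─ T ∣ < ∣ B ─ S ∣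
    ∣A─T∣<∣B─S∣ = +-cancelʳ-< ∣ T ∣ _ _ (begin-strict
      ∣ A ─ T ∣ + ∣ T ∣      ≤⟨ +-monoʳ-≤ ∣ A ─ T ∣ (p⊆q⇒∣p∣≤∣q∣ (λ f∈T → x∈p∩q⁺ (T⊆A f∈T , f∈T))) ⟩
      ∣ A ─ T ∣ + ∣ A ∩ T ∣  ≡⟨ ∣p─q∣+∣p∩q∣≡∣p∣ A T ⟩
      ∣ A ∣                  <⟨ ∣A∣<∣B∣ ⟩
      ∣ B ∣                  ≡⟨ sym (∣p─q∣+∣p∩q∣≡∣p∣ B S) ⟩
      ∣ B ─ S ∣ + ∣ B ∩ S ∣  ≤⟨ +-monoʳ-≤ ∣ B ─ S ∣ ∣B∩S∣≤∣T∣ ⟩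
      ∣ B ─ S ∣ + ∣ T ∣      ∎)
      where open ≤-Reasoning
    widen : Augmentable (A ─ T) (B ─ S) →
            ∃ λ y → y ∈ B × y ∉ A × y ∉ S × Sparse ((A ─ T) ∪ ⁅ y ⁆)
    widen (y , y∈B─S , y∉A─T , sparse) = y , p─q⊆p B S y∈B─S , y∉A , y∉S , sparse
      where
      y∉S : y ∉ S
      y∉S = x∈p─q⇒x∉q B S y∈B─S
      y∉A : y ∉ A
      y∉A y∈A = y∉A─T (x∈p∧x∉q⇒x∈p─q y∈A (λ y∈T → y∉S (∈induced⁺ G (∈vertexSet⁺ G y∈T))))

  tight-grows : ∀ {A T J y} → Sparse A → TightIn A T → y ∉ induced G (vertexSet G T) →
                J ⊆ A ∪ ⁅ y ⁆ → y ∈ J → Nonempty (J ∩ T) → Overfull J →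
                ∃ λ K → TightIn A K × ∣ T ∣ < ∣ K ∣
  tight-grows {A} {T} {J} {y} sparse (T⊆A , (e , e∈T) , tight) y∉S J⊆ y∈J J∩T≢∅ overfull =
    K , (K⊆A , (e , T⊆K e∈T) , proj₁ K-facts) , ∣T∣<∣K∣
    where
    U = J ∪ T
    K = U - y
    y∉T : y ∉ T
    y∉T y∈T = y∉S (∈induced⁺ G (∈vertexSet⁺ G y∈T))
    K⊆A : K ⊆ A
    K⊆A f∈K with x∈p∪q⁻ J T (p─q⊆p U ⁅ y ⁆ f∈K)
    ... | inj₁ f∈J = x∈p∪⁅y⁆∧x≢y⇒x∈p (J⊆ f∈J) (x∉⁅y⁆⇒x≢y (x∈p─q⇒x∉q U ⁅ y ⁆ f∈K))
    ... | inj₂ f∈T = T⊆A f∈T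
    T⊆K : T ⊆ K
    T⊆K f∈T = x∈p∧x≢y⇒x∈p-y (q⊆p∪q J T f∈T) (λ f≡y → y∉T (subst (_∈ T) f≡y f∈T))
    K-facts : Tight K × vertexSet G U ⊆ vertexSet G K
    K-facts = Overfull-remove {U} y
      (Overfull-∪ {J} overfull tight (sparse (⊆-trans (p∩q⊆q J T) T⊆A) J∩T≢∅))
      (sparse K⊆A (e , T⊆K e∈T))
    ∣T∣<∣K∣ : ∣ T ∣ < ∣ K ∣
    ∣T∣<∣K∣ with ∣ K ∣ ≤? ∣ T ∣
    ... | no  ∣K∣≰∣T∣ = ≰⇒> ∣K∣≰∣T∣
    ... | yes ∣K∣≤∣T∣ = ⊥-elim (y∉S (∈induced⁺ G λ v∈y →
      vertexSet-mono G (p⊆q∧∣q∣≤∣p∣⇒q⊆p T⊆K ∣K∣≤∣T∣)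
        (proj₂ K-facts (∈vertexSet⁺ G (p⊆p∪q T y∈J) v∈y))))

  augment-or-grow : ∀ {n A B T} → AugmentsBelow n → ∣ A ∣ ≤ n → Sparse A → Sparse B →
                    ∣ A ∣ < ∣ B ∣ → TightIn A T →
                    Augmentable A B ⊎ ∃ λ K → TightIn A K × ∣ T ∣ < ∣ K ∣
  augment-or-grow {A = A} {T = T} below ∣A∣≤n spA spB ∣A∣<∣B∣ T-tight
    with augment-outside below ∣A∣≤n spA spB ∣A∣<∣B∣ T-tight
  ... | y , y∈B , y∉A , y∉S , sparse-outside with sparse⊎overfull (A ∪ ⁅ y ⁆)
  ...   | inj₁ sparse = inj₁ (y , y∈B , y∉A , sparse)
  ...   | inj₂ (J , J⊆ , neJ , overfull) with y ∈? J | nonempty? (J ∩ T)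
  ...     | no  y∉J | _ = ⊥-elim (<⇒≱ overfull (spA (p⊆q∪⁅x⁆∧x∉p⇒p⊆q J⊆ y∉J) neJ))
  ...     | yes _   | no J∩T≡∅ =
    ⊥-elim (<⇒≱ overfull (sparse-outside (p⊆q∪⁅x⁆∧p∩r≡∅⇒p⊆q─r∪⁅x⁆ J⊆ J∩T≡∅) neJ))
  ...     | yes y∈J | yes J∩T≢∅ = inj₂ (tight-grows spA T-tight y∉S J⊆ y∈J J∩T≢∅ overfull)

  augment-from-empty : ∀ {A B} → Empty A → Sparse B → ∣ A ∣ < ∣ B ∣ → Augmentable A B
  augment-from-empty {A} {B} A≡∅ spB ∣A∣<∣B∣ =
    x , x∈B , (λ x∈A → A≡∅ (x , x∈A)) , Sparse-⊆ A∪x⊆B spB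
    where
    B≢∅ : Nonempty B
    B≢∅ = 0<∣p∣⇒Nonempty (≤-trans (s≤s z≤n) ∣A∣<∣B∣)
    x = proj₁ B≢∅
    x∈B = proj₂ B≢∅
    A∪x⊆B : A ∪ ⁅ x ⁆ ⊆ B
    A∪x⊆B y∈ with x∈p∪q⁻ A ⁅ x ⁆ y∈
    ... | inj₁ y∈A = ⊥-elim (A≡∅ (_ , y∈A))
    ... | inj₂ y∈x = x∈p⇒⁅x⁆⊆p x∈B y∈x

  augmentsBelow : ∀ n → AugmentsBelow n
  augmentsBelow zero    ()
  augmentsBelow (suc n) {A} {B} ∣A∣<1+n spA spB ∣A∣<∣B∣ with nonempty? A
  ... | no  A≡∅         = augment-from-empty A≡∅ spB ∣A∣<∣B∣
  ... | yes (e , e∈A) = escape-increasing (TightIn A) ∣_∣ ∣ A ∣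
    (λ (K⊆A , _) → p⊆q⇒∣p∣≤∣q∣ K⊆A)
    (augment-or-grow (augmentsBelow n) (≤-pred ∣A∣<1+n) spA spB ∣A∣<∣B∣)
    (x∈p⇒⁅x⁆⊆p e∈A , (e , x∈⁅x⁆ e) , ⁅e⁆-tight e)

  Sparse-isMatroid : IsMatroid E Sparse
  Sparse-isMatroid = record
    { empty-indep  = Sparse-⊥
    ; hereditary   = Sparse-⊆
    ; augmentation = λ {A} → augmentsBelow (suc ∣ A ∣) ≤-refl
    }

lemmaB2 : (G : Graph) (k : ℕ) → 1 ≤ k →
    IsMatroid (Graph.E G) (λ K → m₂≤ G K k)
lemmaB2 G k 1≤k = IsMatroid-transfer Sparse⇒m₂≤ m₂≤⇒Sparse Sparse-isMatroid
  where open Sparsity G k 1≤k
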